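{- Let $n\ge1$ and $m>2^n$ be integers, and consider a play of the game described in the context in which Kronecker uses the ``0 first'' strategy and Cantor queries all $mn$ entries in an arbitrary (adaptive) order; let $L_t$ be the state matrix after $t$ queries. Let $(i,j)$ be the last entry queried (the unique entry with $L_{mn-1}(i,j)=\star$). Then row $L_{mn-1}(i)$ is essential for $L_{mn-1}$.
   Context: Kronecker holds $v_1,\ldots,v_m\in\{0,1\}^n$; Cantor queries entries ``bit $j$ of vector $i$''. The state is an $m\times n$ matrix $L$ over $\{0,1,\star\}$, where $L(i,j)=\star$ means bit $j$ of $v_i$ is not yet queried and otherwise it is Kronecker's answer; $L_0$ is all $\star$, each query is to a $\star$ entry, and $L(i)$ denotes row $i$. A set $S$ of $2^n$ rows of $L$ is useful if, after replacing each $\star$ in $S$ by $0$ or $1$ suitably, the rows of $S$ are exactly the $2^n$ distinct vectors of $\{0,1\}^n$. $L$ is unblocked if it has a useful set of rows, and blocked otherwise. For an unblocked $L$, row $L(i)$ is essential for $L$ if every useful set of rows of $L$ contains $L(i)$. The ``0 first'' strategy: when entry $(i,j)$ is queried, Kronecker answers $1$ if setting $L(i,j)$ to $0$ would make $L$ blocked, and $0$ otherwise. -}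

module Defs where

open import Data.Nat using (ℕ; zero; suc; _*_; _^_; _∸_; _<_)
open import Data.Fin using (Fin) renaming (_≟_ to _≟ᶠ_)
open import Data.Fin.Subset using (Subset; _∈_; ∣_∣)
open import Data.Bool using (Bool; true; false)
open import Data.Maybe using (Maybe; just; nothing)
open import Data.Product using (Σ; _×_; _,_; ∃-syntax)
open import Relation.Nullary using (¬_; yes; no)
open import Relation.Binary.PropositionalEquality using (_≡_)

-- An entry of the state matrix: nothing = ⋆ (unqueried), just b = answer b.
Cell : Set
Cell = Maybe Bool

Mat : ℕ → ℕ → Set
Mat m n = Fin m → Fin n → Cell

allStar : ∀ {m n} → Mat m n
allStar _ _ = nothing

setEntry : ∀ {m n} → Mat m n → Fin m → Fin n → Bool → Mat m n
setEntry L i j b i' j' with i' ≟ᶠ i | j' ≟ᶠ j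
... | yes _ | yes _ = just b
... | _     | _     = L i' j'

Compatible : ∀ {m n} → Mat m n → Fin m → (Fin n → Bool) → Set
Compatible L i v = ∀ j b → L i j ≡ just b → v j ≡ b

-- S (a set of 2^n rows) is useful for L: after replacing each ⋆ in the rows of S
-- by 0/1 (the completion g), the rows of S are exactly the 2^n distinct vectors of {0,1}^n.
Useful : ∀ {m n} → Mat m n → Subset m → Set
Useful {m} {n} L S =
  ∣ S ∣ ≡ 2 ^ n ×
  Σ (Fin m → Fin n → Bool) λ g →
      (∀ i → i ∈ S → Compatible L i (g i))
    × (∀ i i' → i ∈ S → i' ∈ S → (∀ j → g i j ≡ g i' j) → i ≡ i')
    × (∀ (v : Fin n → Bool) → ∃[ i ] (i ∈ S × (∀ j → g i j ≡ v j)))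

Unblocked : ∀ {m n} → Mat m n → Set
Unblocked {m} L = ∃[ S ] Useful {m} L S

Blocked : ∀ {m n} → Mat m n → Set
Blocked L = ¬ Unblocked L

Essential : ∀ {m n} → Mat m n → Fin m → Set
Essential {m} L i = Unblocked L × (∀ (S : Subset m) → Useful L S → i ∈ S)

ZeroFirstAnswer : ∀ {m n} → Mat m n → Fin m → Fin n → Bool → Set
ZeroFirstAnswer L i j true  = Blocked (setEntry L i j false)
ZeroFirstAnswer L i j false = ¬ Blocked (setEntry L i j false)

Step : ∀ {m n} → Mat m n → Mat m n → Set
Step {m} {n} L L' =
  Σ (Fin m) λ i → Σ (Fin n) λ j → Σ Bool λ b →
    L i j ≡ nothing × ZeroFirstAnswer L i j b
    × (∀ i' j' → L' i' j' ≡ setEntry L i j b i' j')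

ZeroFirstPlay : ∀ m n → (ℕ → Mat m n) → Set
ZeroFirstPlay m n L =
  (∀ i j → L 0 i j ≡ allStar i j) × (∀ t → t < m * n → Step (L t) (L (suc t)))

{-# OPTIONS --safe #-}
-- Every state of a "0 first" play is unblocked: an answer 0 is only given when it keeps the
-- state unblocked, and an answer 1 keeps any useful set whose completion has 1 at the queried
-- entry (a completion with 0 there would have made the answer 0).  After m·n − 1 queries, (i, j)
-- is the only ⋆ left.  Suppose a useful set S of the final state F avoids row i.  Let w be row i
-- of F with its ⋆ set to 1, and r ∈ S the row completed to w; as (r, j) is no ⋆, F(r, j) = 1.
-- So when (r, j) was queried, setting it to 0 would have blocked the state.  But exchanging r
-- for i in S gives a useful set of exactly that matrix: row i is compatible with w there, and
-- row r, the only one that changed, is no longer used.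
module Submission where

open import Defs
open import Level using (0ℓ)
open import Data.Nat using (ℕ; zero; suc; _+_; _*_; _^_; _∸_; _<_; _≤_; _≤′_; ≤′-refl; ≤′-step; s≤s)
open import Data.Nat.Properties
  using (+-suc; +-identityʳ; *-identityʳ; +-cancelʳ-≡; +-mono-≤; m≤m+n; ≤-refl; n≤1+n; n<1+n; m<n⇒m<1+n;
         <⇒≤; ≤⇒≤′; +-0-commutativeMonoid; module ≤-Reasoning)
  renaming (_≟_ to _≟ℕ_)
open import Data.Fin using (Fin; zero; suc; punchIn; punchOut)
open import Data.Fin.Base using (finToFun; funToFin; combine)
open import Data.Fin.Properties
  using (_≟_; any?; all?; punchInᵢ≢i; punchIn-punchOut; 2↔Bool; funToFin-finToFin; finToFun-funToFin)
open import Data.Fin.Subset using (Subset; _∈_; _∉_; ∣_∣; ⊤; inside; outside)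
open import Data.Fin.Subset.Properties using (_∈?_; anySubset?; ∈⊤; ∣⊤∣≡n)
open import Data.Vec using (_∷_; here; there; _[_]≔_)
open import Data.Vec.Properties
  using ([]≔-updates; []≔-minimal; []=-injective; []=⇒lookup; lookup⇒[]=; lookup∘update′)
open import Data.Vec.Functional using (removeAt; updateAt) renaming (_∷_ to _◂_)
open import Data.Vec.Functional.Properties
  using () renaming (updateAt-updates to updateAt-updatesᶠ; updateAt-minimal to updateAt-minimalᶠ)
open import Data.Vec.Functional.Relation.Binary.Pointwise using (Pointwise)
open import Algebra.Properties.CommutativeMonoid.Sum +-0-commutativeMonoid using (sum; sum-remove; sum-cong-≗)
open import Data.Bool using (Bool; true; false)
open import Data.Bool.Properties using () renaming (_≟_ to _≟ᵇ_)
open import Data.Maybe using (just; nothing; fromMaybe)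
open import Data.Maybe.Properties using (just-injective) renaming (≡-dec to ≡-decᵐ)
open import Data.Product using (∃; _×_; _,_; proj₁; proj₂; ∃-syntax)
open import Data.Sum using (_⊎_; inj₁; inj₂)
open import Data.Empty using (⊥-elim)
open import Function using (_∘_; const; Inverse)
open import Relation.Nullary using (¬_; Dec; yes; no; contradiction)
open import Relation.Nullary.Decidable using (map′; _×-dec_; _→-dec_; ¬?; decidable-stable)
open import Relation.Unary using (Pred; Decidable)
open import Relation.Binary using (Rel; Reflexive; Symmetric; _Respects_)
open import Relation.Binary.PropositionalEquality
  using (_≡_; _≢_; refl; sym; trans; cong; cong₂; subst; subst₂; module ≡-Reasoning)

-- Deciding unblockedness

-- Exhaustive search turns the ¬ Blocked granted by an answer 0 into a useful set.  Predicates
-- must respect pointwise equality of functions, as function extensionality is unavailable.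
Searchable : (A : Set) → Rel A 0ℓ → Set₁
Searchable A _≈_ = ∀ {P : Pred A 0ℓ} → P Respects _≈_ → Decidable P → Dec (∃ P)

Bool-searchable : Searchable Bool _≡_
Bool-searchable _ P? with P? false | P? true
... | yes p | _     = yes (false , p)
... | _     | yes p = yes (true , p)
... | no ¬f | no ¬t = no λ { (false , p) → ¬f p ; (true , p) → ¬t p }

→-searchable : ∀ {A _≈_} → Reflexive _≈_ → Searchable A _≈_ → ∀ k → Searchable (Fin k → A) (Pointwise _≈_)
→-searchable ≈-refl search zero resp P? = map′ (_ ,_) (λ (f , p) → resp (λ ()) p) (P? (λ ()))
→-searchable {A} {_≈_} ≈-refl search (suc k) {P} resp P? =
  map′ (λ (a , f , p) → a ◂ f , p)
       (λ (f , p) → f zero , (f ∘ suc) , resp (λ { zero → ≈-refl ; (suc x) → ≈-refl }) p)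
       (search Q-resp (λ a → →-searchable ≈-refl search k (resp ∘ ◂-cong ≈-refl) (P? ∘ (a ◂_))))
  where
  ◂-cong : ∀ {a a' : A} {f f' : Fin k → A} → a ≈ a' → Pointwise _≈_ f f' → Pointwise _≈_ (a ◂ f) (a' ◂ f')
  ◂-cong a≈a' f≈f' zero    = a≈a'
  ◂-cong a≈a' f≈f' (suc x) = f≈f' x

  Q-resp : (λ a → ∃ λ f → P (a ◂ f)) Respects _≈_
  Q-resp a≈a' (f , p) = f , resp (◂-cong a≈a' (λ _ → ≈-refl)) p

searchable⇒∀? : ∀ {A _≈_} {P : Pred A 0ℓ} → Symmetric _≈_ → Searchable A _≈_ →
                P Respects _≈_ → Decidable P → Dec (∀ a → P a)
searchable⇒∀? ≈-sym search resp P? =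
  map′ (λ ∄¬P a → decidable-stable (P? a) (λ ¬p → ∄¬P (a , ¬p)))
       (λ ∀P (a , ¬p) → ¬p (∀P a))
       (¬? (search (λ a≈a' ¬p p' → ¬p (resp (≈-sym a≈a') p')) (¬? ∘ P?)))

Completion : ∀ {m n} → Mat m n → Subset m → (Fin m → Fin n → Bool) → Set
Completion {m} {n} L S g =
    (∀ i → i ∈ S → Compatible L i (g i))
  × (∀ i i' → i ∈ S → i' ∈ S → (∀ j → g i j ≡ g i' j) → i ≡ i')
  × (∀ (v : Fin n → Bool) → ∃[ i ] (i ∈ S × (∀ j → g i j ≡ v j)))

module _ {m n} (L : Mat m n) (S : Subset m) where

  Completion-respects : Completion L S Respects Pointwise (Pointwise _≡_)
  Completion-respects g≗g' (compatible , injective , surjective) =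
    (λ i i∈S j b e → trans (sym (g≗g' i j)) (compatible i i∈S j b e)) ,
    (λ i i' i∈S i'∈S gi≗gi' →
       injective i i' i∈S i'∈S λ j → trans (g≗g' i j) (trans (gi≗gi' j) (sym (g≗g' i' j)))) ,
    (λ v → let (i , i∈S , gi≗v) = surjective v in i , i∈S , λ j → trans (sym (g≗g' i j)) (gi≗v j))

  completion? : Decidable (Completion L S)
  completion? g =
        all? (λ i → (i ∈? S) →-dec all? λ j → ∀-Bool? λ b → ≡-decᵐ _≟ᵇ_ (L i j) (just b) →-dec (g i j ≟ᵇ b))
    ×-dec all? (λ i → all? λ i' → (i ∈? S) →-dec (i' ∈? S) →-dec all? (λ j → g i j ≟ᵇ g i' j) →-dec (i ≟ i'))
    ×-dec searchable⇒∀? (λ v≗v' j → sym (v≗v' j)) (→-searchable refl Bool-searchable n)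
            (λ v≗v' (i , i∈S , gi≗v) → i , i∈S , λ j → trans (gi≗v j) (v≗v' j))
            (λ v → any? λ i → (i ∈? S) ×-dec all? λ j → g i j ≟ᵇ v j)
    where
    ∀-Bool? : ∀ {Q : Pred Bool 0ℓ} → Decidable Q → Dec (∀ b → Q b)
    ∀-Bool? = searchable⇒∀? sym Bool-searchable (λ { refl q → q })

unblocked? : ∀ {m n} → Decidable (Unblocked {m} {n})
unblocked? {m} {n} L = anySubset? λ S →
  (∣ S ∣ ≟ℕ 2 ^ n) ×-dec →-searchable (λ _ → refl) (→-searchable refl Bool-searchable n) m
                           (Completion-respects L S) (completion? L S)

¬blocked⇒unblocked : ∀ {m n} {L : Mat m n} → ¬ Blocked L → Unblocked L
¬blocked⇒unblocked {L = L} = decidable-stable (unblocked? L)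

-- Setting entries and refining states

module _ {m n} (L : Mat m n) (i : Fin m) (j : Fin n) (b : Bool) where

  setEntry-updates : setEntry L i j b i j ≡ just b
  setEntry-updates with i ≟ i | j ≟ j
  ... | yes _ | yes _    = refl
  ... | no i≢i | _       = contradiction refl i≢i
  ... | yes _ | no j≢j   = contradiction refl j≢j

  setEntry-minimal : ∀ {i' j'} → ¬ (i' ≡ i × j' ≡ j) → setEntry L i j b i' j' ≡ L i' j'
  setEntry-minimal {i'} {j'} ne with i' ≟ i | j' ≟ j
  ... | yes i'≡i | yes j'≡j = contradiction (i'≡i , j'≡j) ne
  ... | yes _    | no _     = refl
  ... | no _     | yes _    = refl
  ... | no _     | no _     = refl

  Compatible-setEntry : ∀ {k w} → Compatible L k w → (k ≡ i → w j ≡ b) → Compatible (setEntry L i j b) k w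
  Compatible-setEntry {k} compatible k≡i⇒wj≡b y c e with (k ≟ i) ×-dec (y ≟ j)
  ... | yes (refl , refl) = trans (k≡i⇒wj≡b refl) (just-injective (trans (sym setEntry-updates) e))
  ... | no ne             = compatible y c (trans (sym (setEntry-minimal ne)) e)

  Completion-setEntry : ∀ {S g} → Completion L S g → (i ∈ S → g i j ≡ b) → Completion (setEntry L i j b) S g
  Completion-setEntry (compatible , injective , surjective) i∈S⇒gij≡b =
    (λ k k∈S → Compatible-setEntry (compatible k k∈S) λ { refl → i∈S⇒gij≡b k∈S }) , injective , surjective

zeroFirst-preserves-unblocked : ∀ {m n} {L : Mat m n} {i j b} →
  Unblocked L → ZeroFirstAnswer L i j b → Unblocked (setEntry L i j b)
zeroFirst-preserves-unblocked {b = false} _ answer = ¬blocked⇒unblocked answer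
zeroFirst-preserves-unblocked {L = L} {i} {j} {true} (S , size , g , completion) blocked with g i j in gij
... | true  = S , size , g , Completion-setEntry L i j true completion λ _ → gij
... | false = contradiction (S , size , g , Completion-setEntry L i j false completion λ _ → gij) blocked

infix 4 _⊑_

_⊑_ : ∀ {m n} → Mat m n → Mat m n → Set
L ⊑ L' = ∀ x y {b} → L x y ≡ just b → L' x y ≡ just b

module _ {m n : ℕ} where

  ⊑-refl : {L : Mat m n} → L ⊑ L
  ⊑-refl _ _ e = e

  ⊑-trans : {L L' L'' : Mat m n} → L ⊑ L' → L' ⊑ L'' → L ⊑ L''
  ⊑-trans L⊑L' L'⊑L'' x y = L'⊑L'' x y ∘ L⊑L' x y

  ≗⇒⊑ : {L L' : Mat m n} → (∀ x y → L x y ≡ L' x y) → L ⊑ L'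
  ≗⇒⊑ L≗L' x y e = trans (sym (L≗L' x y)) e

  setEntry-⊒ : {L : Mat m n} {i : Fin m} {j : Fin n} {b : Bool} → L i j ≡ nothing → L ⊑ setEntry L i j b
  setEntry-⊒ {L} {i} {j} {b} Lij≡⋆ x y e with (x ≟ i) ×-dec (y ≟ j)
  ... | yes (refl , refl) = contradiction (trans (sym Lij≡⋆) e) λ ()
  ... | no ne             = trans (setEntry-minimal L i j b ne) e

  setEntry-mono : {L L' : Mat m n} {i : Fin m} {j : Fin n} {b : Bool} → L ⊑ L' → setEntry L i j b ⊑ setEntry L' i j b
  setEntry-mono {L} {L'} {i} {j} {b} L⊑L' x y e with (x ≟ i) ×-dec (y ≟ j)
  ... | yes (refl , refl) = trans (setEntry-updates L' i j b) (trans (sym (setEntry-updates L i j b)) e)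
  ... | no ne             = trans (setEntry-minimal L' i j b ne) (L⊑L' x y (trans (sym (setEntry-minimal L i j b ne)) e))

  Useful-antitone : {L L' : Mat m n} {S : Subset m} → L ⊑ L' → Useful L' S → Useful L S
  Useful-antitone L⊑L' (size , g , compatible , injective , surjective) =
    size , g , (λ k k∈S y c → compatible k k∈S y c ∘ L⊑L' k y) , injective , surjective

  Unblocked-antitone : {L L' : Mat m n} → L ⊑ L' → Unblocked L' → Unblocked L
  Unblocked-antitone L⊑L' (S , useful) = S , Useful-antitone L⊑L' useful

-- Counting unqueried entries

sum-const : ∀ k c → sum {k} (const c) ≡ k * c
sum-const zero    c = refl
sum-const (suc k) c = cong (c +_) (sum-const k c)

sum-decrement : ∀ {k} (f g : Fin k → ℕ) i → f i ≡ suc (g i) → (∀ x → x ≢ i → f x ≡ g x) → sum f ≡ suc (sum g)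
sum-decrement {suc k} f g i fi≡1+gi f≗g = begin
  sum f                           ≡⟨ sum-remove f ⟩
  f i + sum (removeAt f i)        ≡⟨ cong₂ _+_ fi≡1+gi (sum-cong-≗ λ x → f≗g (punchIn i x) (punchInᵢ≢i i x)) ⟩
  suc (g i + sum (removeAt g i))  ≡⟨ cong suc (sum-remove g) ⟨
  suc (sum g)                     ∎
  where open ≡-Reasoning

sum-single-≤ : ∀ {k} (f : Fin k → ℕ) i → f i ≤ sum f
sum-single-≤ {suc k} f i = begin
  f i                       ≤⟨ m≤m+n (f i) _ ⟩
  f i + sum (removeAt f i)  ≡⟨ sum-remove f ⟨
  sum f                     ∎
  where open ≤-Reasoning

sum-pair-≤ : ∀ {k} (f : Fin k → ℕ) {i r} → i ≢ r → f i + f r ≤ sum f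
sum-pair-≤ {suc k} f {i} {r} i≢r = begin
  f i + f r                           ≡⟨ cong (λ x → f i + f x) (sym (punchIn-punchOut i≢r)) ⟩
  f i + removeAt f i (punchOut i≢r)   ≤⟨ +-mono-≤ ≤-refl (sum-single-≤ (removeAt f i) (punchOut i≢r)) ⟩
  f i + sum (removeAt f i)            ≡⟨ sum-remove f ⟨
  sum f                               ∎
  where open ≤-Reasoning

isStar : Cell → ℕ
isStar nothing  = 1
isStar (just _) = 0

stars : ∀ {m n} → Mat m n → ℕ
stars L = sum λ i → sum λ j → isStar (L i j)

module _ {m n : ℕ} where

  stars-allStar : stars (allStar {m} {n}) ≡ m * n
  stars-allStar = trans (sum-cong-≗ {m} λ _ → trans (sum-const n 1) (*-identityʳ n)) (sum-const m n)

  stars-cong : {L L' : Mat m n} → (∀ x y → L x y ≡ L' x y) → stars L ≡ stars L'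
  stars-cong L≗L' = sum-cong-≗ λ x → sum-cong-≗ λ y → cong isStar (L≗L' x y)

  stars-setEntry : (L : Mat m n) {i : Fin m} {j : Fin n} (b : Bool) → L i j ≡ nothing →
                   stars L ≡ suc (stars (setEntry L i j b))
  stars-setEntry L {i} {j} b Lij≡⋆ =
    sum-decrement _ _ i
      (sum-decrement _ _ j (trans (cong isStar Lij≡⋆) (cong (suc ∘ isStar) (sym (setEntry-updates L i j b))))
         λ y y≢j → cong isStar (sym (setEntry-minimal L i j b λ (_ , y≡j) → y≢j y≡j)))
      λ x x≢i → sum-cong-≗ {n} λ y → cong isStar (sym (setEntry-minimal L i j b λ (x≡i , _) → x≢i x≡i))

  two-stars : (L : Mat m n) {i r : Fin m} {j : Fin n} → i ≢ r → L i j ≡ nothing → L r j ≡ nothing → 2 ≤ stars L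
  two-stars L {i} {r} {j} i≢r Lij≡⋆ Lrj≡⋆ = begin
    1 + 1                   ≤⟨ +-mono-≤ (star-in-row Lij≡⋆) (star-in-row Lrj≡⋆) ⟩
    row i + row r           ≤⟨ sum-pair-≤ row i≢r ⟩
    stars L                 ∎
    where
    open ≤-Reasoning
    row : Fin m → ℕ
    row x = sum λ y → isStar (L x y)
    star-in-row : ∀ {x} → L x j ≡ nothing → 1 ≤ row x
    star-in-row {x} Lxj≡⋆ = subst (_≤ row x) (cong isStar Lxj≡⋆) (sum-single-≤ (λ y → isStar (L x y)) j)

  stars≡1⇒unique : (L : Mat m n) {i r : Fin m} {j : Fin n} → stars L ≡ 1 → L i j ≡ nothing → L r j ≡ nothing → r ≡ i
  stars≡1⇒unique L {i} {r} stars≡1 Lij≡⋆ Lrj≡⋆ = decidable-stable (r ≟ i) λ r≢i →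
    contradiction (subst (2 ≤_) stars≡1 (two-stars L r≢i Lrj≡⋆ Lij≡⋆)) λ { (s≤s ()) }

-- Exchanging a row of a useful set

∈-[]≔⁻ : ∀ {m} {p : Subset m} {x y b} → y ∈ p [ x ]≔ b → y ≢ x → y ∈ p
∈-[]≔⁻ {p = p} {x} {y} {b} y∈p[x]≔b y≢x =
  lookup⇒[]= y p (trans (sym (lookup∘update′ y≢x p b)) ([]=⇒lookup y∈p[x]≔b))

∉-[]≔outside : ∀ {m} (p : Subset m) x → x ∉ p [ x ]≔ outside
∉-[]≔outside p x x∈p[x]≔outside = contradiction ([]=-injective ([]≔-updates p x) x∈p[x]≔outside) λ ()

∣[]≔inside∣ : ∀ {m} (p : Subset m) {x} → x ∉ p → ∣ p [ x ]≔ inside ∣ ≡ suc ∣ p ∣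
∣[]≔inside∣ (outside ∷ p) {zero}  x∉p = refl
∣[]≔inside∣ (inside  ∷ p) {zero}  x∉p = contradiction here x∉p
∣[]≔inside∣ (outside ∷ p) {suc x} x∉p = ∣[]≔inside∣ p (x∉p ∘ there)
∣[]≔inside∣ (inside  ∷ p) {suc x} x∉p = cong suc (∣[]≔inside∣ p (x∉p ∘ there))

∣[]≔outside∣ : ∀ {m} (p : Subset m) {x} → x ∈ p → suc ∣ p [ x ]≔ outside ∣ ≡ ∣ p ∣
∣[]≔outside∣ (inside  ∷ p) {zero}  here        = refl
∣[]≔outside∣ (outside ∷ p) {suc x} (there x∈p) = ∣[]≔outside∣ p x∈p
∣[]≔outside∣ (inside  ∷ p) {suc x} (there x∈p) = cong suc (∣[]≔outside∣ p x∈p)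

module _ {m n} {F : Mat m n} {S : Subset m} {g : Fin m → Fin n → Bool}
         (completion : Completion F S g) {r i : Fin m} (r∈S : r ∈ S) (i∉S : i ∉ S)
         (compatible-i : Compatible F i (g r)) where

  private
    S' : Subset m
    S' = S [ r ]≔ outside [ i ]≔ inside

    g' : Fin m → Fin n → Bool
    g' = updateAt g i (const (g r))

    compatible : ∀ k → k ∈ S → Compatible F k (g k)
    compatible = proj₁ completion

    injective : ∀ k k' → k ∈ S → k' ∈ S → (∀ y → g k y ≡ g k' y) → k ≡ k'
    injective = proj₁ (proj₂ completion)

    surjective : ∀ v → ∃[ k ] (k ∈ S × (∀ y → g k y ≡ v y))
    surjective = proj₂ (proj₂ completion)

    ∈S⇒≢i : ∀ {k} → k ∈ S → k ≢ i
    ∈S⇒≢i k∈S refl = i∉S k∈S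

    i≢r : i ≢ r
    i≢r = ∈S⇒≢i r∈S ∘ sym

    g'-i : g' i ≡ g r
    g'-i = updateAt-updatesᶠ i g

    g'-≢i : ∀ {k} → k ≢ i → g' k ≡ g k
    g'-≢i k≢i = updateAt-minimalᶠ _ i g k≢i

    i∈S' : i ∈ S'
    i∈S' = []≔-updates (S [ r ]≔ outside) i

    ∈S-≢r⇒∈S' : ∀ {k} → k ∈ S → k ≢ r → k ∈ S'
    ∈S-≢r⇒∈S' k∈S k≢r = []≔-minimal _ _ i (∈S⇒≢i k∈S) ([]≔-minimal S _ r k≢r k∈S)

    ∈S'⁻ : ∀ {k} → k ∈ S' → k ≡ i ⊎ (k ∈ S × k ≢ r)
    ∈S'⁻ {k} k∈S' with k ≟ i
    ... | yes k≡i = inj₁ k≡i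
    ... | no  k≢i = inj₂ (∈-[]≔⁻ k∈S[r]≔outside k≢r , k≢r)
      where
      k∈S[r]≔outside : k ∈ S [ r ]≔ outside
      k∈S[r]≔outside = ∈-[]≔⁻ k∈S' k≢i
      k≢r : k ≢ r
      k≢r refl = ∉-[]≔outside S r k∈S[r]≔outside

    compatible' : ∀ j b k → k ∈ S' → Compatible (setEntry F r j b) k (g' k)
    compatible' j b k k∈S' with ∈S'⁻ k∈S'
    ... | inj₁ refl        = subst (Compatible (setEntry F r j b) i) (sym g'-i)
                               (Compatible-setEntry F r j b compatible-i (⊥-elim ∘ i≢r))
    ... | inj₂ (k∈S , k≢r) = subst (Compatible (setEntry F r j b) k) (sym (g'-≢i (∈S⇒≢i k∈S)))
                               (Compatible-setEntry F r j b (compatible k k∈S) (⊥-elim ∘ k≢r))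

    injective' : ∀ k k' → k ∈ S' → k' ∈ S' → (∀ y → g' k y ≡ g' k' y) → k ≡ k'
    injective' k k' k∈S' k'∈S' g'k≗g'k' with ∈S'⁻ k∈S' | ∈S'⁻ k'∈S'
    ... | inj₁ refl        | inj₁ refl          = refl
    ... | inj₁ refl        | inj₂ (k'∈S , k'≢r) =
      contradiction (sym (injective r k' r∈S k'∈S (subst₂ (Pointwise _≡_) g'-i (g'-≢i (∈S⇒≢i k'∈S)) g'k≗g'k'))) k'≢r
    ... | inj₂ (k∈S , k≢r) | inj₁ refl          =
      contradiction (sym (injective r k r∈S k∈S (subst₂ (Pointwise _≡_) g'-i (g'-≢i (∈S⇒≢i k∈S)) (sym ∘ g'k≗g'k')))) k≢r
    ... | inj₂ (k∈S , _)   | inj₂ (k'∈S , _)    = injective k k' k∈S k'∈S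
      (subst₂ (Pointwise _≡_) (g'-≢i (∈S⇒≢i k∈S)) (g'-≢i (∈S⇒≢i k'∈S)) g'k≗g'k')

    surjective' : ∀ v → ∃[ k ] (k ∈ S' × (∀ y → g' k y ≡ v y))
    surjective' v with surjective v
    ... | k , k∈S , gk≗v with k ≟ r
    ...   | yes refl = i , i∈S' , subst (λ u → Pointwise _≡_ u v) (sym g'-i) gk≗v
    ...   | no  k≢r  = k , ∈S-≢r⇒∈S' k∈S k≢r , subst (λ u → Pointwise _≡_ u v) (sym (g'-≢i (∈S⇒≢i k∈S))) gk≗v

  Useful-exchange : ∣ S ∣ ≡ 2 ^ n → ∀ j b → Useful (setEntry F r j b) (S [ r ]≔ outside [ i ]≔ inside)
  Useful-exchange size j b =
    trans (∣[]≔inside∣ (S [ r ]≔ outside) (λ i∈ → i∉S (∈-[]≔⁻ i∈ i≢r))) (trans (∣[]≔outside∣ S r∈S) size) ,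
    g' , compatible' j b , injective' , surjective'

-- Plays

module _ {m n} {L L' : Mat m n} where

  Step⇒⊑ : Step L L' → L ⊑ L'
  Step⇒⊑ (i , j , b , Lij≡⋆ , _ , L'≗) = ⊑-trans (setEntry-⊒ Lij≡⋆) (≗⇒⊑ λ x y → sym (L'≗ x y))

  Step-unblocked : Step L L' → Unblocked L → Unblocked L'
  Step-unblocked (i , j , b , _ , answer , L'≗) unblocked =
    Unblocked-antitone (≗⇒⊑ L'≗) (zeroFirst-preserves-unblocked unblocked answer)

  Step-stars : Step L L' → stars L ≡ suc (stars L')
  Step-stars (i , j , b , Lij≡⋆ , _ , L'≗) = trans (stars-setEntry L b Lij≡⋆) (cong suc (sym (stars-cong L'≗)))

  Step-true⇒blocked : Step L L' → ∀ {x y} → L x y ≡ nothing → L' x y ≡ just true → Blocked (setEntry L x y false)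
  Step-true⇒blocked (i , j , b , _ , answer , L'≗) {x} {y} Lxy≡⋆ L'xy≡1 with (x ≟ i) ×-dec (y ≟ j)
  ... | yes (refl , refl) = subst (ZeroFirstAnswer L x y) b≡true answer
    where
    b≡true : b ≡ true
    b≡true = just-injective (trans (sym (trans (L'≗ x y) (setEntry-updates L x y b))) L'xy≡1)
  ... | no ne = contradiction ⋆≡1 λ ()
    where
    ⋆≡1 : nothing ≡ just true
    ⋆≡1 = trans (sym Lxy≡⋆) (trans (sym (setEntry-minimal L i j b ne)) (trans (sym (L'≗ x y)) L'xy≡1))

funToFin-cong : ∀ {k l} {f f' : Fin k → Fin l} → (∀ x → f x ≡ f' x) → funToFin f ≡ funToFin f'
funToFin-cong {zero}  _     = refl
funToFin-cong {suc k} f≗f' = cong₂ combine (f≗f' zero) (funToFin-cong (f≗f' ∘ suc))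

module _ {n : ℕ} where

  open Inverse 2↔Bool using (to; from; strictlyInverseˡ; strictlyInverseʳ)

  decodeBits : Fin (2 ^ n) → Fin n → Bool
  decodeBits c = to ∘ finToFun c

  encodeBits : (Fin n → Bool) → Fin (2 ^ n)
  encodeBits v = funToFin (from ∘ v)

  decodeBits-encodeBits : ∀ v j → decodeBits (encodeBits v) j ≡ v j
  decodeBits-encodeBits v j = trans (cong to (finToFun-funToFin (from ∘ v) j)) (strictlyInverseˡ (v j))

  decodeBits-injective : ∀ {c c'} → (∀ j → decodeBits c j ≡ decodeBits c' j) → c ≡ c'
  decodeBits-injective {c} {c'} c≈c' = begin
    c                               ≡⟨ funToFin-finToFin {n} {2} c ⟨
    funToFin (finToFun {2} {n} c)   ≡⟨ funToFin-cong finToFun-c≗c' ⟩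
    funToFin (finToFun {2} {n} c')  ≡⟨ funToFin-finToFin {n} {2} c' ⟩
    c'                              ∎
    where
    open ≡-Reasoning
    finToFun-c≗c' : ∀ j → finToFun c j ≡ finToFun c' j
    finToFun-c≗c' j = trans (sym (strictlyInverseʳ _)) (trans (cong from (c≈c' j)) (strictlyInverseʳ _))

  allStar-unblocked : ∀ {m} → 2 ^ n ≤ m → Unblocked (allStar {m} {n})
  allStar-unblocked = go ∘ ≤⇒≤′
    where
    go : ∀ {m} → 2 ^ n ≤′ m → Unblocked (allStar {m} {n})
    go ≤′-refl = ⊤ , ∣⊤∣≡n _ , decodeBits , (λ _ _ _ _ ()) , (λ _ _ _ _ → decodeBits-injective) ,
                 λ v → encodeBits v , ∈⊤ , decodeBits-encodeBits v
    go (≤′-step 2ⁿ≤′m) with go 2ⁿ≤′m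
    ... | S , size , g , _ , injective , surjective =
      outside ∷ S , size , const false ◂ g , (λ _ _ _ _ ()) ,
      (λ { (suc k) (suc k') (there k∈S) (there k'∈S) gk≗gk' → cong suc (injective k k' k∈S k'∈S gk≗gk') }) ,
      λ v → let k , k∈S , gk≗v = surjective v in suc k , there k∈S , gk≗v

module Play {m n} (L : ℕ → Mat m n) (N : ℕ) (step : ∀ t → t < N → Step (L t) (L (suc t))) where

  play-⊑ : ∀ {s t} → s ≤ t → t ≤ N → L s ⊑ L t
  play-⊑ {s} = go ∘ ≤⇒≤′
    where
    go : ∀ {t} → s ≤′ t → t ≤ N → L s ⊑ L t
    go ≤′-refl           _   = ⊑-refl
    go (≤′-step s≤′t) t<N = ⊑-trans (go s≤′t (<⇒≤ t<N)) (Step⇒⊑ (step _ t<N))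

  play-unblocked : Unblocked (L 0) → ∀ t → t ≤ N → Unblocked (L t)
  play-unblocked unblocked zero    _   = unblocked
  play-unblocked unblocked (suc t) t<N = Step-unblocked (step t t<N) (play-unblocked unblocked t (<⇒≤ t<N))

  play-stars : ∀ t → t ≤ N → stars (L t) + t ≡ stars (L 0)
  play-stars zero    _   = +-identityʳ _
  play-stars (suc t) t<N = begin
    stars (L (suc t)) + suc t   ≡⟨ +-suc _ t ⟩
    suc (stars (L (suc t))) + t ≡⟨ cong (_+ t) (Step-stars (step t t<N)) ⟨
    stars (L t) + t             ≡⟨ play-stars t (<⇒≤ t<N) ⟩
    stars (L 0)                 ∎
    where open ≡-Reasoning

  answered-true⇒blocked : ∀ t → t ≤ N → ∀ {x y} → L 0 x y ≡ nothing → L t x y ≡ just true →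
                          ∃[ s ] (s < t × Blocked (setEntry (L s) x y false))
  answered-true⇒blocked zero    _   L0xy≡⋆ L0xy≡1 = contradiction (trans (sym L0xy≡⋆) L0xy≡1) λ ()
  answered-true⇒blocked (suc t) t<N {x} {y} L0xy≡⋆ Lxy≡1 with L t x y in Ltxy
  ... | nothing = t , n<1+n t , Step-true⇒blocked (step t t<N) Ltxy Lxy≡1
  ... | just b  with answered-true⇒blocked t (<⇒≤ t<N) L0xy≡⋆ (trans Ltxy (cong just b≡true))
    where
    b≡true : b ≡ true
    b≡true = just-injective (trans (sym (Step⇒⊑ (step t t<N) x y Ltxy)) Lxy≡1)
  ...   | s , s<t , blocked = s , m<n⇒m<1+n s<t , blocked

lastStar-essential : ∀ {m n K} (L : ℕ → Mat m n) → ZeroFirstPlay m n L → m * n ≡ suc K →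
                     Unblocked (allStar {m} {n}) → ∀ i j → L K i j ≡ nothing → Essential (L K) i
lastStar-essential {m} {n} {K} L (initial , step) mn≡1+K unblocked₀ i j Fij≡⋆ =
  play-unblocked (Unblocked-antitone (≗⇒⊑ initial) unblocked₀) K (n≤1+n K) ,
  λ S useful → decidable-stable (i ∈? S) (i∉useful S useful)
  where
  open Play L (suc K) (λ t → step t ∘ subst (t <_) (sym mn≡1+K))

  F : Mat m n
  F = L K

  stars-F : stars F ≡ 1
  stars-F = +-cancelʳ-≡ K (stars F) 1
    (trans (play-stars K (n≤1+n K)) (trans (stars-cong initial) (trans (stars-allStar {m} {n}) mn≡1+K)))

  -- Since F i j is a ⋆, a row covering w carries a 1 at j.
  w : Fin n → Bool
  w y = fromMaybe true (F i y)

  w-covering-row : ∀ {S r} (g : Fin m → Fin n → Bool) → (∀ k → k ∈ S → Compatible F k (g k)) →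
                   i ∉ S → r ∈ S → (∀ y → g r y ≡ w y) → F r j ≡ just true
  w-covering-row {r = r} g compatible i∉S r∈S gr≗w with F r j in Frj
  ... | nothing = contradiction (subst (_∈ _) (stars≡1⇒unique F stars-F Fij≡⋆ Frj) r∈S) i∉S
  ... | just b  = cong just (trans (sym (compatible r r∈S j b Frj)) (trans (gr≗w j) (cong (fromMaybe true) Fij≡⋆)))

  i∉useful : ∀ S → Useful F S → ¬ (i ∉ S)
  i∉useful S (size , g , completion@(compatible , _ , surjective)) i∉S with surjective w
  ... | r , r∈S , gr≗w
    with answered-true⇒blocked K (n≤1+n K) (initial r j) (w-covering-row g compatible i∉S r∈S gr≗w)
  ...   | s , s<K , blocked =
    blocked (_ , Useful-antitone (setEntry-mono (play-⊑ (<⇒≤ s<K) (n≤1+n K)))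
                                 (Useful-exchange completion r∈S i∉S compatible-i size j false))
    where
    compatible-i : Compatible F i (g r)
    compatible-i y b Fiy≡b = trans (gr≗w y) (cong (fromMaybe true) Fiy≡b)

lemma4p10 : ∀ (n m : ℕ) → 1 ≤ n → 2 ^ n < m → (L : ℕ → Mat m n) → ZeroFirstPlay m n L →
    ∀ (i : Fin m) (j : Fin n) → L (m * n ∸ 1) i j ≡ nothing → Essential (L (m * n ∸ 1)) i
lemma4p10 zero    _       ()  _    _ _    _ _
lemma4p10 (suc n) zero    _   ()   _ _    _ _
lemma4p10 (suc n) (suc m) _   2ⁿ<m L play =
  lastStar-essential L play refl (allStar-unblocked (<⇒≤ 2ⁿ<m))
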